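{- Let $n\ge 1$ and let $L_S$ be the $(4n+1)\times(4n+1)$ symmetric tridiagonal matrix whose off-diagonal entries $(L_S)_{j,j+1}=(L_S)_{j+1,j}$ are all $-1$ and whose diagonal entries are $d_1=d_{4n+1}=3$ and, for $2\le j\le 4n$, $d_j=4$ if $j\equiv 0$ or $1 \pmod 4$ and $d_j=2$ if $j\equiv 2$ or $3\pmod 4$. Put $A=15+4\sqrt{14}$, $B=15-4\sqrt{14}$. Then \[ \det(L_S)=\frac{(116+31\sqrt{14})A^{n-1}-(116-31\sqrt{14})B^{n-1}}{\sqrt{14}}. \]
   Context: The matrix $L_S$ arises as $L_{V_1V_1}-L_{V_1V_2}$ for the Laplacian of the linear octagonal-quadrilateral network $L_n$ (vertices $1,\dots,4n+1$, $1',\dots,(4n+1)'$; edges $\{j,j+1\}$, $\{j',(j+1)'\}$ for $1\le j\le 4n$, and $\{j,j'\}$ for $j=1$ and for $j\equiv 0,1 \pmod 4$, $4\le j\le 4n+1$), with $V_1=\{1,\dots,4n+1\}$, $V_2=\{1',\dots,(4n+1)'\}$. -}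

module Defs where

open import Data.Nat as ℕ using (ℕ; zero; suc; _%_)
open import Data.Integer as ℤ using (ℤ; +_; -_)
open import Data.Fin using (Fin; zero; suc; toℕ; punchIn)
open import Data.Bool using (Bool; true; false; if_then_else_; _∨_)
open import Relation.Nullary.Decidable using (⌊_⌋)

Matrix : ℕ → Set
Matrix n = Fin n → Fin n → ℤ

sumFin : (n : ℕ) → (Fin n → ℤ) → ℤ
sumFin zero    f = + 0
sumFin (suc n) f = f zero ℤ.+ sumFin n (λ j → f (suc j))

sgn : ℕ → ℤ
sgn zero    = + 1
sgn (suc k) = - sgn k

minor : ∀ {n} → Matrix (suc n) → Fin (suc n) → Matrix n
minor M j r c = M (suc r) (punchIn j c)

det : (n : ℕ) → Matrix n → ℤ
det zero    M = + 1
det (suc n) M = sumFin (suc n) (λ j → sgn (toℕ j) ℤ.* (M zero j ℤ.* det n (minor M j)))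

-- Diagonal entry d_k (1-based index k) for the (4n+1)x(4n+1) matrix L_S.
diagEntry : (n k : ℕ) → ℤ
diagEntry n k =
  if ⌊ k ℕ.≟ 1 ⌋ ∨ ⌊ k ℕ.≟ (4 ℕ.* n ℕ.+ 1) ⌋ then + 3
  else (if ⌊ k % 4 ℕ.≟ 0 ⌋ ∨ ⌊ k % 4 ℕ.≟ 1 ⌋ then + 4 else + 2)

entry : (n i j : ℕ) → ℤ
entry n i j =
  if ⌊ i ℕ.≟ j ⌋ then diagEntry n i
  else (if ⌊ suc i ℕ.≟ j ⌋ ∨ ⌊ suc j ℕ.≟ i ⌋ then - (+ 1) else + 0)

LS : (n : ℕ) → Matrix (4 ℕ.* n ℕ.+ 1)
LS n i j = entry n (suc (toℕ i)) (suc (toℕ j))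

-- The ring ℤ[√14]: ⟨ a , b ⟩ represents a + b·√14.
record ℤ√14 : Set where
  constructor ⟨_,_⟩
  field
    re : ℤ
    im : ℤ

infixl 6 _+√_ _-√_
infixl 7 _*√_

_+√_ : ℤ√14 → ℤ√14 → ℤ√14
⟨ a , b ⟩ +√ ⟨ c , d ⟩ = ⟨ a ℤ.+ c , b ℤ.+ d ⟩

_-√_ : ℤ√14 → ℤ√14 → ℤ√14
⟨ a , b ⟩ -√ ⟨ c , d ⟩ = ⟨ a ℤ.- c , b ℤ.- d ⟩

_*√_ : ℤ√14 → ℤ√14 → ℤ√14
⟨ a , b ⟩ *√ ⟨ c , d ⟩ = ⟨ a ℤ.* c ℤ.+ + 14 ℤ.* (b ℤ.* d) , a ℤ.* d ℤ.+ b ℤ.* c ⟩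

_^√_ : ℤ√14 → ℕ → ℤ√14
x ^√ zero  = ⟨ + 1 , + 0 ⟩
x ^√ suc k = x *√ (x ^√ k)

ι : ℤ → ℤ√14
ι a = ⟨ a , + 0 ⟩

√14 : ℤ√14
√14 = ⟨ + 0 , + 1 ⟩

A B : ℤ√14
A = ⟨ + 15 , + 4 ⟩
B = ⟨ + 15 , - (+ 4) ⟩

module Submission where

open import Defs
open import Data.Nat using (ℕ; _≤_; _*_; _+_; _∸_)
open import Data.Integer using (+_; -_)
open import Relation.Binary.PropositionalEquality using (_≡_)

open import Data.Bool using (if_then_else_; _∨_)
open import Data.Bool.Properties using (∨-zeroʳ)
open import Data.Fin using (Fin; zero; suc; toℕ; punchIn)
open import Data.Integer as ℤ using (ℤ)
import Data.Integer.Properties as ℤₚ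
open import Data.Integer.Tactic.RingSolver using (solve-∀)
open import Data.Nat using (zero; suc; _<_; _%_; _≟_; s≤s; z≤n)
import Data.Nat.Properties as ℕₚ
open import Data.Product using (_×_; _,_; proj₁; proj₂)
open import Function using (_∘_; _∘′_)
open import Relation.Binary.PropositionalEquality
  using (refl; sym; trans; cong; cong₂; module ≡-Reasoning)
open import Relation.Nullary.Decidable using (⌊_⌋; does; isYes≗does; dec-true; dec-false)

open ≡-Reasoning

-- Expanding along the first row, the determinant of a tridiagonal matrix with
-- off-diagonal entries -1 is the continuant K(d₀,…,d_{m-1}) of its diagonal, and the
-- pair (K(d₀,…), K(d₁,…)) transforms linearly when a diagonal entry is prepended.
-- The diagonal of L_S is 3,2,2,4, then n-1 periods 4,2,2,4, then 3.  One period acts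
-- by the matrix [[33,-10],[10,-3]], which is conjugate to multiplication by
-- A = 15+4√14 on ℤ[√14]; so after t periods the pair is (3a+11b, a+3b) where
-- A^t = a+b√14, and det L_S = 62a+232b = 2·Im((116+31√14)A^{n-1}).  Since B^t is the
-- conjugate of A^t, this is the claimed formula multiplied by √14.

sumFin-cong : ∀ n {f g : Fin n → ℤ} → (∀ i → f i ≡ g i) → sumFin n f ≡ sumFin n g
sumFin-cong zero    f≗g = refl
sumFin-cong (suc n) f≗g = cong₂ ℤ._+_ (f≗g zero) (sumFin-cong n (f≗g ∘ suc))

sumFin-zero : ∀ n {f : Fin n → ℤ} → (∀ i → f i ≡ + 0) → sumFin n f ≡ + 0
sumFin-zero zero    f≗0 = refl
sumFin-zero (suc n) f≗0 = cong₂ ℤ._+_ (f≗0 zero) (sumFin-zero n (f≗0 ∘ suc))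

det-cong : ∀ n {M N : Matrix n} → (∀ i j → M i j ≡ N i j) → det n M ≡ det n N
det-cong zero    M≗N = refl
det-cong (suc n) M≗N = sumFin-cong (suc n) λ j →
  cong₂ (λ a x → sgn (toℕ j) ℤ.* (a ℤ.* x))
        (M≗N zero j) (det-cong n λ r c → M≗N (suc r) (punchIn j c))

cofactor-vanishes : ∀ s a x → a ℤ.* x ≡ + 0 → s ℤ.* (a ℤ.* x) ≡ + 0
cofactor-vanishes s a x ax≡0 = trans (cong (s ℤ.*_) ax≡0) (ℤₚ.*-zeroʳ s)

det-firstColumn-upper : ∀ m (M : Matrix (suc m)) → (∀ i → M (suc i) zero ≡ + 0) →
  det (suc m) M ≡ M zero zero ℤ.* det m (minor M zero)
det-firstColumn-upper m M below = begin
  det (suc m) M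
    ≡⟨⟩
  + 1 ℤ.* (M zero zero ℤ.* det m (minor M zero))
    ℤ.+ sumFin m (λ j → sgn (toℕ (suc j)) ℤ.* (M zero (suc j) ℤ.* det m (minor M (suc j))))
    ≡⟨ cong₂ ℤ._+_ (ℤₚ.*-identityˡ (M zero zero ℤ.* det m (minor M zero))) (sumFin-zero m λ j →
         cofactor-vanishes (sgn (toℕ (suc j))) (M zero (suc j)) (det m (minor M (suc j)))
           (trans (cong (M zero (suc j) ℤ.*_) (singular-minor M below j))
                  (ℤₚ.*-zeroʳ (M zero (suc j))))) ⟩
  M zero zero ℤ.* det m (minor M zero) ℤ.+ + 0
    ≡⟨ ℤₚ.+-identityʳ _ ⟩
  M zero zero ℤ.* det m (minor M zero)
    ∎
  where
  -- The first column of this minor vanishes entirely, top entry included.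
  singular-minor : ∀ {m} (M : Matrix (suc m)) → (∀ i → M (suc i) zero ≡ + 0) →
    (j : Fin m) → det m (minor M (suc j)) ≡ + 0
  singular-minor {suc m} M below j =
    trans (det-firstColumn-upper m (minor M (suc j)) (below ∘ suc))
          (cong (ℤ._* det m (minor (minor M (suc j)) zero)) (below zero))

det-twoTerm-expansion : ∀ m (M : Matrix (suc (suc m))) →
  (∀ j → M zero (suc (suc j)) ≡ + 0) → (∀ i → M (suc (suc i)) zero ≡ + 0) →
  det (suc (suc m)) M
    ≡ M zero zero ℤ.* det (suc m) (minor M zero)
      ℤ.- M zero (suc zero) ℤ.* (M (suc zero) zero ℤ.* det m (λ r c → M (suc (suc r)) (suc (suc c))))
det-twoTerm-expansion m M right below =
  trans (cong₂ (λ y z → + 1 ℤ.* (M zero zero ℤ.* det (suc m) (minor M zero))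
                         ℤ.+ (- (+ 1) ℤ.* (M zero (suc zero) ℤ.* y) ℤ.+ z))
               (det-firstColumn-upper m (minor M (suc zero)) below)
               (sumFin-zero m λ j →
                  cofactor-vanishes (sgn (toℕ (suc (suc j)))) (M zero (suc (suc j)))
                                    (det (suc m) (minor M (suc (suc j))))
                                    (cong (ℤ._* det (suc m) (minor M (suc (suc j)))) (right j))))
        (two-terms (M zero zero) (det (suc m) (minor M zero)) (M zero (suc zero)) (M (suc zero) zero)
                   (det m (λ r c → M (suc (suc r)) (suc (suc c)))))
  where
  two-terms : ∀ a x b c y →
    + 1 ℤ.* (a ℤ.* x) ℤ.+ (- (+ 1) ℤ.* (b ℤ.* (c ℤ.* y)) ℤ.+ + 0) ≡ a ℤ.* x ℤ.- b ℤ.* (c ℤ.* y)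
  two-terms = solve-∀

-- Tested with does rather than ⌊_⌋ so that does (suc i ≟ suc j) reduces to does (i ≟ j):
-- then the leading minors of tridiagonal d are tridiagonal (d ∘′ suc) definitionally.
bandEntry : (ℕ → ℤ) → ℕ → ℕ → ℤ
bandEntry d i j =
  if does (i ≟ j) then d i
  else (if does (suc i ≟ j) ∨ does (suc j ≟ i) then - (+ 1) else + 0)

tridiagonal : (ℕ → ℤ) → (m : ℕ) → Matrix m
tridiagonal d m r c = bandEntry d (toℕ r) (toℕ c)

continuant : (ℕ → ℤ) → ℕ → ℤ
continuant d zero          = + 1
continuant d (suc zero)    = d 0
continuant d (suc (suc m)) = d 0 ℤ.* continuant (d ∘′ suc) (suc m) ℤ.- continuant (d ∘′ suc ∘′ suc) m

det-tridiagonal : ∀ d m → det m (tridiagonal d m) ≡ continuant d m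
det-tridiagonal d zero = refl
det-tridiagonal d (suc zero) =
  trans (det-firstColumn-upper 0 (tridiagonal d 1) λ ()) (ℤₚ.*-identityʳ (d 0))
det-tridiagonal d (suc (suc m)) = begin
  det (suc (suc m)) (tridiagonal d (suc (suc m)))
    ≡⟨ det-twoTerm-expansion m (tridiagonal d (suc (suc m))) (λ _ → refl) (λ _ → refl) ⟩
  d 0 ℤ.* det (suc m) (tridiagonal (d ∘′ suc) (suc m))
    ℤ.- - (+ 1) ℤ.* (- (+ 1) ℤ.* det m (tridiagonal (d ∘′ suc ∘′ suc) m))
    ≡⟨ cong₂ (λ x y → d 0 ℤ.* x ℤ.- - (+ 1) ℤ.* (- (+ 1) ℤ.* y))
             (det-tridiagonal (d ∘′ suc) (suc m)) (det-tridiagonal (d ∘′ suc ∘′ suc) m) ⟩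
  d 0 ℤ.* continuant (d ∘′ suc) (suc m) ℤ.- - (+ 1) ℤ.* (- (+ 1) ℤ.* continuant (d ∘′ suc ∘′ suc) m)
    ≡⟨ signs (d 0) _ _ ⟩
  continuant d (suc (suc m))
    ∎
  where
  signs : ∀ a x y → a ℤ.* x ℤ.- - (+ 1) ℤ.* (- (+ 1) ℤ.* y) ≡ a ℤ.* x ℤ.- y
  signs = solve-∀

entry≡bandEntry : ∀ n i j → entry n i j ≡ bandEntry (diagEntry n) i j
entry≡bandEntry n i j
  rewrite isYes≗does (i ≟ j) | isYes≗does (suc i ≟ j) | isYes≗does (suc j ≟ i) = refl

LS-tridiagonal : ∀ n i j → LS n i j ≡ tridiagonal (diagEntry n ∘ suc) (4 * n + 1) i j
LS-tridiagonal n i j = entry≡bandEntry n (suc (toℕ i)) (suc (toℕ j))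

4n+1≡1+n*4 : ∀ n → 4 * n + 1 ≡ suc (n * 4)
4n+1≡1+n*4 n = trans (ℕₚ.+-comm (4 * n) 1) (cong suc (ℕₚ.*-comm 4 n))

interior : ℕ → ℤ
interior r = if ⌊ r ≟ 0 ⌋ ∨ ⌊ r ≟ 1 ⌋ then + 4 else + 2

diagEntry-interior : ∀ n k → 1 < k → k ≤ n * 4 → diagEntry n k ≡ interior (k % 4)
diagEntry-interior n k 1<k k≤n*4
  rewrite isYes≗does (k ≟ 1) | dec-false (k ≟ 1) (ℕₚ.>⇒≢ 1<k)
        | isYes≗does (k ≟ 4 * n + 1)
        | dec-false (k ≟ 4 * n + 1) (λ k≡ → ℕₚ.<⇒≢ (s≤s k≤n*4) (trans k≡ (4n+1≡1+n*4 n)))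
  = refl

diagEntry-last : ∀ n → diagEntry n (4 * n + 1) ≡ + 3
diagEntry-last n
  rewrite isYes≗does (4 * n + 1 ≟ 4 * n + 1) | dec-true (4 * n + 1 ≟ 4 * n + 1) refl
        | ∨-zeroʳ ⌊ 4 * n + 1 ≟ 1 ⌋
  = refl

continuants : (ℕ → ℤ) → ℕ → ℤ × ℤ
continuants d m = continuant d (suc m) , continuant (d ∘′ suc) m

prepend : ℤ → ℤ × ℤ → ℤ × ℤ
prepend a (x , y) = a ℤ.* x ℤ.- y , x

prepend-2-2-4 : ∀ a x y →
  prepend a (prepend (+ 2) (prepend (+ 2) (prepend (+ 4) (x , y))))
    ≡ ((+ 10 ℤ.* a ℤ.- + 7) ℤ.* x ℤ.- (+ 3 ℤ.* a ℤ.- + 2) ℤ.* y , + 10 ℤ.* x ℤ.- + 3 ℤ.* y)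
prepend-2-2-4 a x y = cong₂ _,_ (first a x y) (second x y)
  where
  first : ∀ a x y →
    a ℤ.* (+ 2 ℤ.* (+ 2 ℤ.* (+ 4 ℤ.* x ℤ.- y) ℤ.- x) ℤ.- (+ 4 ℤ.* x ℤ.- y))
      ℤ.- (+ 2 ℤ.* (+ 4 ℤ.* x ℤ.- y) ℤ.- x)
    ≡ (+ 10 ℤ.* a ℤ.- + 7) ℤ.* x ℤ.- (+ 3 ℤ.* a ℤ.- + 2) ℤ.* y
  first = solve-∀
  second : ∀ x y → + 2 ℤ.* (+ 2 ℤ.* (+ 4 ℤ.* x ℤ.- y) ℤ.- x) ℤ.- (+ 4 ℤ.* x ℤ.- y) ≡ + 10 ℤ.* x ℤ.- + 3 ℤ.* y
  second = solve-∀

tailPair : ℤ√14 → ℤ × ℤ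
tailPair ⟨ a , b ⟩ = + 3 ℤ.* a ℤ.+ + 11 ℤ.* b , a ℤ.+ + 3 ℤ.* b

tailPair-A : ∀ X →
  prepend (+ 4) (prepend (+ 2) (prepend (+ 2) (prepend (+ 4) (tailPair X)))) ≡ tailPair (A *√ X)
tailPair-A ⟨ a , b ⟩ =
  trans (prepend-2-2-4 (+ 4) (+ 3 ℤ.* a ℤ.+ + 11 ℤ.* b) (a ℤ.+ + 3 ℤ.* b))
        (cong₂ _,_ (first a b) (second a b))
  where
  first : ∀ a b → + 33 ℤ.* (+ 3 ℤ.* a ℤ.+ + 11 ℤ.* b) ℤ.- + 10 ℤ.* (a ℤ.+ + 3 ℤ.* b)
    ≡ + 3 ℤ.* (+ 15 ℤ.* a ℤ.+ + 14 ℤ.* (+ 4 ℤ.* b)) ℤ.+ + 11 ℤ.* (+ 15 ℤ.* b ℤ.+ + 4 ℤ.* a)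
  first = solve-∀
  second : ∀ a b → + 10 ℤ.* (+ 3 ℤ.* a ℤ.+ + 11 ℤ.* b) ℤ.- + 3 ℤ.* (a ℤ.+ + 3 ℤ.* b)
    ≡ (+ 15 ℤ.* a ℤ.+ + 14 ℤ.* (+ 4 ℤ.* b)) ℤ.+ + 3 ℤ.* (+ 15 ℤ.* b ℤ.+ + 4 ℤ.* a)
  second = solve-∀

-- The hypotheses say that d begins with (4,2,2,4)^t followed by 3.
continuants-tail : ∀ t (d : ℕ → ℤ) → (∀ i → i < t * 4 → d i ≡ interior (suc i % 4)) →
  d (t * 4) ≡ + 3 → continuants d (t * 4) ≡ tailPair (A ^√ t)
continuants-tail zero    d _    last = cong (_, + 1) last
continuants-tail (suc t) d bulk last = begin
  continuants d (suc t * 4)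
    ≡⟨⟩
  prepend (d 0) (prepend (d 1) (prepend (d 2) (prepend (d 3) (continuants (λ i → d (4 + i)) (t * 4)))))
    ≡⟨ cong₂ prepend (bulk 0 (s≤s z≤n)) (cong₂ prepend (bulk 1 (s≤s (s≤s z≤n)))
         (cong₂ prepend (bulk 2 (s≤s (s≤s (s≤s z≤n)))) (cong₂ prepend (bulk 3 (s≤s (s≤s (s≤s (s≤s z≤n)))))
           (continuants-tail t (λ i → d (4 + i)) (λ i i< → bulk (4 + i) (ℕₚ.+-monoʳ-< 4 i<)) last)))) ⟩
  prepend (+ 4) (prepend (+ 2) (prepend (+ 2) (prepend (+ 4) (tailPair (A ^√ t)))))
    ≡⟨ tailPair-A (A ^√ t) ⟩
  tailPair (A ^√ suc t)
    ∎

conj : ℤ√14 → ℤ√14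
conj ⟨ a , b ⟩ = ⟨ a , - b ⟩

conj-*√ : ∀ x y → conj (x *√ y) ≡ conj x *√ conj y
conj-*√ ⟨ a , b ⟩ ⟨ c , d ⟩ = cong₂ ⟨_,_⟩ (re a b c d) (im a b c d)
  where
  re : ∀ a b c d → a ℤ.* c ℤ.+ + 14 ℤ.* (b ℤ.* d) ≡ a ℤ.* c ℤ.+ + 14 ℤ.* (- b ℤ.* - d)
  re = solve-∀
  im : ∀ a b c d → - (a ℤ.* d ℤ.+ b ℤ.* c) ≡ a ℤ.* - d ℤ.+ - b ℤ.* c
  im = solve-∀

conj-^√ : ∀ x t → conj (x ^√ t) ≡ conj x ^√ t
conj-^√ x zero    = refl
conj-^√ x (suc t) = trans (conj-*√ x (x ^√ t)) (cong (conj x *√_) (conj-^√ x t))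

x-conj-x : ∀ x → x -√ conj x ≡ ⟨ + 0 , + 2 ℤ.* ℤ√14.im x ⟩
x-conj-x ⟨ a , b ⟩ = cong₂ ⟨_,_⟩ (ℤₚ.+-inverseʳ a) (twice b)
  where
  twice : ∀ b → b ℤ.- - b ≡ + 2 ℤ.* b
  twice = solve-∀

ι*√√14 : ∀ x → ι x *√ √14 ≡ ⟨ + 0 , x ⟩
ι*√√14 x = cong₂ ⟨_,_⟩ (re x) (im x)
  where
  re : ∀ x → x ℤ.* + 0 ℤ.+ + 14 ℤ.* (+ 0 ℤ.* + 1) ≡ + 0
  re = solve-∀
  im : ∀ x → x ℤ.* + 1 ℤ.+ + 0 ℤ.* + 0 ≡ x
  im = solve-∀

α : ℤ√14
α = ⟨ + 116 , + 31 ⟩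

det-LS : ∀ n → det (4 * suc n + 1) (LS (suc n)) ≡ + 2 ℤ.* ℤ√14.im (α *√ (A ^√ n))
det-LS n = begin
  det (4 * suc n + 1) (LS (suc n))
    ≡⟨ det-cong (4 * suc n + 1) (LS-tridiagonal (suc n)) ⟩
  det (4 * suc n + 1) (tridiagonal δ (4 * suc n + 1))
    ≡⟨ det-tridiagonal δ (4 * suc n + 1) ⟩
  continuant δ (4 * suc n + 1)
    ≡⟨ cong (continuant δ) (4n+1≡1+n*4 (suc n)) ⟩
  proj₁ (prepend (δ 0) (prepend (δ 1) (prepend (δ 2) (prepend (δ 3) (continuants (λ i → δ (4 + i)) (n * 4))))))
    ≡⟨ cong proj₁ (cong (prepend (+ 3)) (cong₂ prepend (prefix 0 z≤n) (cong₂ prepend (prefix 1 (s≤s z≤n))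
         (cong₂ prepend (prefix 2 (s≤s (s≤s z≤n))) (continuants-tail n (λ i → δ (4 + i)) bulk last))))) ⟩
  proj₁ (prepend (+ 3) (prepend (+ 2) (prepend (+ 2) (prepend (+ 4) (tailPair (A ^√ n))))))
    ≡⟨ cong proj₁ (prepend-2-2-4 (+ 3) (proj₁ (tailPair (A ^√ n))) (proj₂ (tailPair (A ^√ n)))) ⟩
  + 23 ℤ.* proj₁ (tailPair (A ^√ n)) ℤ.- + 7 ℤ.* proj₂ (tailPair (A ^√ n))
    ≡⟨ closing (ℤ√14.re (A ^√ n)) (ℤ√14.im (A ^√ n)) ⟩
  + 2 ℤ.* ℤ√14.im (α *√ (A ^√ n))
    ∎
  where
  δ : ℕ → ℤ
  δ i = diagEntry (suc n) (suc i)
  prefix : ∀ r → r ≤ 2 → δ (suc r) ≡ interior ((2 + r) % 4)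
  prefix r r≤2 = diagEntry-interior (suc n) (2 + r) (s≤s (s≤s z≤n))
                   (ℕₚ.+-monoʳ-≤ 2 (ℕₚ.m≤n⇒m≤n+o (n * 4) (ℕₚ.≤-trans r≤2 (s≤s (s≤s z≤n)))))
  bulk : ∀ i → i < n * 4 → δ (4 + i) ≡ interior (suc i % 4)
  bulk i i< = diagEntry-interior (suc n) (5 + i) (s≤s (s≤s z≤n)) (ℕₚ.+-monoʳ-< 4 i<)
  last : δ (4 + n * 4) ≡ + 3
  last = trans (cong (diagEntry (suc n)) (sym (4n+1≡1+n*4 (suc n)))) (diagEntry-last (suc n))
  closing : ∀ a b → + 23 ℤ.* (+ 3 ℤ.* a ℤ.+ + 11 ℤ.* b) ℤ.- + 7 ℤ.* (a ℤ.+ + 3 ℤ.* b)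
    ≡ + 2 ℤ.* (+ 116 ℤ.* b ℤ.+ + 31 ℤ.* a)
  closing = solve-∀

lemma3p4 : (n : ℕ) → 1 ≤ n →
    ι (det (4 * n + 1) (LS n)) *√ √14
      ≡ ⟨ + 116 , + 31 ⟩ *√ (A ^√ (n ∸ 1)) -√ ⟨ + 116 , - (+ 31) ⟩ *√ (B ^√ (n ∸ 1))
lemma3p4 (suc n) _ = begin
  ι (det (4 * suc n + 1) (LS (suc n))) *√ √14
    ≡⟨ ι*√√14 _ ⟩
  ⟨ + 0 , det (4 * suc n + 1) (LS (suc n)) ⟩
    ≡⟨ cong ⟨ + 0 ,_⟩ (det-LS n) ⟩
  ⟨ + 0 , + 2 ℤ.* ℤ√14.im (α *√ (A ^√ n)) ⟩
    ≡⟨ sym (x-conj-x (α *√ (A ^√ n))) ⟩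
  α *√ (A ^√ n) -√ conj (α *√ (A ^√ n))
    ≡⟨ cong (α *√ (A ^√ n) -√_) (trans (conj-*√ α (A ^√ n)) (cong (conj α *√_) (conj-^√ A n))) ⟩
  α *√ (A ^√ n) -√ conj α *√ (conj A ^√ n)
    ∎
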